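{- Let $\Gamma=(V,E)$ be a simple graph of order $n$ and maximum degree $\Delta$. Then the global defensive alliance number of $\Gamma$ satisfies $$\gamma_a(\Gamma)\ge \left\lceil\frac{2n}{\Delta+3}\right\rceil,$$ and the global strong defensive alliance number of $\Gamma$ satisfies $$\gamma_{\hat a}(\Gamma)\ge \left\lceil\frac{n}{\left\lfloor\frac{\Delta}{2}\right\rfloor+1}\right\rceil.$$
   Context: For $S\subseteq V$ and $v\in V$, let $N_S(v)=\{u\in S: u\sim v\}$ and $N_{V\setminus S}(v)=\{u\in V\setminus S: u\sim v\}$. A nonempty set $S\subseteq V$ is a defensive alliance if $|N_S(v)|+1\ge |N_{V\setminus S}(v)|$ for every $v\in S$, and a strong defensive alliance if $|N_S(v)|\ge |N_{V\setminus S}(v)|$ for every $v\in S$. A (strong) defensive alliance is global if it is a dominating set, i.e. every vertex of $V\setminus S$ is adjacent to at least one vertex of $S$. $\gamma_a(\Gamma)$ (resp. $\gamma_{\hat a}(\Gamma)$) is the minimum cardinality of a global defensive (resp. global strong defensive) alliance. -}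

module Defs where

open import Data.Nat using (ℕ; zero; suc; _+_; _∸_; _⊔_; _≤_; NonZero)
open import Data.Nat.DivMod using (_/_)
open import Data.Bool using (Bool; true; false; _∧_; not; if_then_else_)
open import Data.Fin using (Fin)
open import Data.Fin.Subset using (Subset; _∈_; _∉_; ∣_∣; Nonempty)
open import Data.List using (List; foldr; map)
open import Data.Nat.ListAction using (sum)
open import Data.List.Base using (allFin)
open import Data.Vec using (lookup)
open import Data.Product using (∃; _×_)
open import Relation.Binary.PropositionalEquality using (_≡_)

record SimpleGraph (n : ℕ) : Set where
  field
    adj    : Fin n → Fin n → Bool
    sym    : ∀ u v → adj u v ≡ adj v u
    irrefl : ∀ v → adj v v ≡ false
open SimpleGraph public

countB : {n : ℕ} → (Fin n → Bool) → ℕ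
countB {n} p = sum (map (λ u → if p u then 1 else 0) (allFin n))

deg : {n : ℕ} → SimpleGraph n → Fin n → ℕ
deg G v = countB (adj G v)

-- maximum degree Δ (0 for the empty graph on no vertices)
maxDeg : {n : ℕ} → SimpleGraph n → ℕ
maxDeg {n} G = foldr _⊔_ 0 (map (deg G) (allFin n))

degIn : {n : ℕ} → SimpleGraph n → Subset n → Fin n → ℕ
degIn G S v = countB (λ u → lookup S u ∧ adj G v u)

degOut : {n : ℕ} → SimpleGraph n → Subset n → Fin n → ℕ
degOut G S v = countB (λ u → not (lookup S u) ∧ adj G v u)

DefensiveAlliance : {n : ℕ} → SimpleGraph n → Subset n → Set
DefensiveAlliance G S =
  Nonempty S × (∀ v → v ∈ S → degOut G S v ≤ degIn G S v + 1)

StrongDefensiveAlliance : {n : ℕ} → SimpleGraph n → Subset n → Set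
StrongDefensiveAlliance G S =
  Nonempty S × (∀ v → v ∈ S → degOut G S v ≤ degIn G S v)

Dominating : {n : ℕ} → SimpleGraph n → Subset n → Set
Dominating G S = ∀ v → v ∉ S → ∃ λ u → u ∈ S × adj G v u ≡ true

GlobalDefensiveAlliance : {n : ℕ} → SimpleGraph n → Subset n → Set
GlobalDefensiveAlliance G S = DefensiveAlliance G S × Dominating G S

GlobalStrongDefensiveAlliance : {n : ℕ} → SimpleGraph n → Subset n → Set
GlobalStrongDefensiveAlliance G S = StrongDefensiveAlliance G S × Dominating G S

⌈_/_⌉ : ℕ → (b : ℕ) → {{NonZero b}} → ℕ
⌈ a / b ⌉ = (a + b ∸ 1) / b

{-# OPTIONS --safe #-}
-- A dominating set S leaves every vertex outside S with a neighbour in S, so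
-- n − |S| is at most the number of edges between S and V ∖ S. In a defensive
-- alliance each v ∈ S has 2 |N_{V∖S}(v)| ≤ deg v + 1 ≤ Δ + 1, in a strong one
-- 2 |N_{V∖S}(v)| ≤ Δ; summing over S bounds that number of edges by
-- |S| (Δ + 1) / 2, resp. |S| ⌊Δ / 2⌋, and both inequalities follow.
module Submission where

open import Defs hiding (sym)
open import Data.Nat using (ℕ; suc; _+_; _*_; _≤_; _/_)
open import Data.Fin.Subset using (Subset; ∣_∣)
open import Data.Product using (_×_)

open import Algebra.Bundles using (CommutativeMonoid)
open import Data.Bool using (Bool; true; false; _∧_; not; if_then_else_)
open import Data.Bool.Properties using (∧-commutativeMonoid; not-¬)
open import Data.Fin using (Fin; zero; suc)
open import Data.Fin.Subset using (_∈_)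
open import Data.List using (List; foldr; tabulate)
open import Data.List.Membership.Propositional using () renaming (_∈_ to _∈ₗ_)
open import Data.List.Membership.Propositional.Properties using (∈-map⁺; ∈-allFin)
open import Data.List.Properties using (map-tabulate)
open import Data.List.Relation.Unary.Any using (here; there)
open import Data.Nat using (zero; _∸_; _⊔_; z≤n; s≤s; NonZero)
open import Data.Nat.DivMod using (m<n*o⇒m/o<n; m*n/n≡m; /-congˡ; /-monoˡ-≤)
open import Data.Nat.ListAction using () renaming (sum to listSum)
open import Data.Nat.Properties
open import Data.Product using (_,_)
open import Data.Vec using ([]; _∷_; lookup)
open import Data.Vec.Properties using (lookup⇒[]=; []=⇒lookup)
open import Function using (_∘_)
open import Relation.Binary.PropositionalEquality

open import Algebra.Properties.Semiring.Sum +-*-semiring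
  using (sum-syntax; sum-cong-≗; sum-replicate-zero; ∑-distrib-+; ∑-comm; *-distribˡ-sum; *-distribʳ-sum)
open import Algebra.Properties.CommutativeSemigroup
  (CommutativeMonoid.commutativeSemigroup ∧-commutativeMonoid)
  using (x∙yz≈y∙xz)

≤-foldr-⊔ : ∀ {x} {xs : List ℕ} → x ∈ₗ xs → x ≤ foldr _⊔_ 0 xs
≤-foldr-⊔ (here refl)  = m≤m⊔n _ _
≤-foldr-⊔ (there x∈xs) = m≤n⇒m≤o⊔n _ (≤-foldr-⊔ x∈xs)

m*n≤o⇒n≤o/m : ∀ m n o .{{_ : NonZero m}} → m * n ≤ o → n ≤ o / m
m*n≤o⇒n≤o/m m n o m*n≤o = begin
  n         ≡⟨ m*n/n≡m n m ⟨
  n * m / m ≡⟨ /-congˡ (*-comm n m) ⟩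
  m * n / m ≤⟨ /-monoˡ-≤ m m*n≤o ⟩
  o / m     ∎
  where open ≤-Reasoning

m≤o*n⇒⌈m/n⌉≤o : ∀ m n o {{_ : NonZero n}} → m ≤ o * n → ⌈ m / n ⌉ ≤ o
m≤o*n⇒⌈m/n⌉≤o m (suc n) o m≤o*n = ≤-pred (m<n*o⇒m/o<n (begin-strict
  m + suc n ∸ 1 ≡⟨ cong (_∸ 1) (+-suc m n) ⟩
  m + n         ≤⟨ +-monoˡ-≤ n m≤o*n ⟩
  o * suc n + n ≡⟨ +-comm (o * suc n) n ⟩
  n + o * suc n <⟨ n<1+n _ ⟩
  suc o * suc n ∎))
  where open ≤-Reasoning

∑-mono-≤ : ∀ {n} {f g : Fin n → ℕ} → (∀ i → f i ≤ g i) → ∑[ i < n ] f i ≤ ∑[ i < n ] g i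
∑-mono-≤ {zero}  f≤g = z≤n
∑-mono-≤ {suc n} f≤g = +-mono-≤ (f≤g zero) (∑-mono-≤ (f≤g ∘ suc))

∑-const-1 : ∀ n → ∑[ i < n ] 1 ≡ n
∑-const-1 zero    = refl
∑-const-1 (suc n) = cong suc (∑-const-1 n)

term≤∑ : ∀ {n} (f : Fin n → ℕ) i → f i ≤ ∑[ j < n ] f j
term≤∑ f zero    = m≤m+n _ _
term≤∑ f (suc i) = m≤n⇒m≤o+n (f zero) (term≤∑ (f ∘ suc) i)

listSum-tabulate : ∀ {n} (f : Fin n → ℕ) → listSum (tabulate f) ≡ ∑[ i < n ] f i
listSum-tabulate {zero}  f = refl
listSum-tabulate {suc n} f = cong (f zero +_) (listSum-tabulate (f ∘ suc))

𝟙 : Bool → ℕ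
𝟙 b = if b then 1 else 0

countB≡∑𝟙 : ∀ {n} (p : Fin n → Bool) → countB p ≡ ∑[ u < n ] 𝟙 (p u)
countB≡∑𝟙 p = trans (cong listSum (map-tabulate (λ u → u) (𝟙 ∘ p))) (listSum-tabulate (𝟙 ∘ p))

𝟙*countB : ∀ {n} b (p : Fin n → Bool) → 𝟙 b * countB p ≡ ∑[ u < n ] 𝟙 (b ∧ p u)
𝟙*countB     true  p = trans (*-identityˡ (countB p)) (countB≡∑𝟙 p)
𝟙*countB {n} false p = sym (sum-replicate-zero n)

1≤countB : ∀ {n} (p : Fin n → Bool) {w} → p w ≡ true → 1 ≤ countB p
1≤countB {n} p {w} pw = begin
  1                  ≡⟨ cong 𝟙 pw ⟨
  𝟙 (p w)            ≤⟨ term≤∑ (𝟙 ∘ p) w ⟩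
  ∑[ u < n ] 𝟙 (p u) ≡⟨ countB≡∑𝟙 p ⟨
  countB p           ∎
  where open ≤-Reasoning

∣S∣≡∑𝟙 : ∀ {n} (S : Subset n) → ∣ S ∣ ≡ ∑[ u < n ] 𝟙 (lookup S u)
∣S∣≡∑𝟙 []          = refl
∣S∣≡∑𝟙 (true ∷ S)  = cong suc (∣S∣≡∑𝟙 S)
∣S∣≡∑𝟙 (false ∷ S) = ∣S∣≡∑𝟙 S

deg≤maxDeg : ∀ {n} (G : SimpleGraph n) v → deg G v ≤ maxDeg G
deg≤maxDeg G v = ≤-foldr-⊔ (∈-map⁺ (deg G) (∈-allFin v))

degIn+degOut≡deg : ∀ {n} (G : SimpleGraph n) S v → degIn G S v + degOut G S v ≡ deg G v
degIn+degOut≡deg {n} G S v = begin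
  degIn G S v + degOut G S v
    ≡⟨ cong₂ _+_ (countB≡∑𝟙 inS) (countB≡∑𝟙 outS) ⟩
  ∑[ u < n ] 𝟙 (inS u) + ∑[ u < n ] 𝟙 (outS u)
    ≡⟨ ∑-distrib-+ (𝟙 ∘ inS) (𝟙 ∘ outS) ⟨
  ∑[ u < n ] (𝟙 (inS u) + 𝟙 (outS u))
    ≡⟨ sum-cong-≗ (λ u → partition (lookup S u) (adj G v u)) ⟩
  ∑[ u < n ] 𝟙 (adj G v u)
    ≡⟨ countB≡∑𝟙 (adj G v) ⟨
  deg G v ∎
  where
  open ≡-Reasoning
  inS outS : Fin n → Bool
  inS  u = lookup S u ∧ adj G v u
  outS u = not (lookup S u) ∧ adj G v u
  partition : ∀ s a → 𝟙 (s ∧ a) + 𝟙 (not s ∧ a) ≡ 𝟙 a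
  partition true  a = +-identityʳ (𝟙 a)
  partition false a = refl

degOut≤degIn+r⇒2*degOut≤r+deg : ∀ {n} (G : SimpleGraph n) S v {r} →
  degOut G S v ≤ degIn G S v + r → 2 * degOut G S v ≤ r + deg G v
degOut≤degIn+r⇒2*degOut≤r+deg G S v {r} o≤i+r = begin
  2 * o       ≡⟨ cong (o +_) (+-identityʳ o) ⟩
  o + o       ≤⟨ +-monoˡ-≤ o o≤i+r ⟩
  i + r + o   ≡⟨ cong (_+ o) (+-comm i r) ⟩
  r + i + o   ≡⟨ +-assoc r i o ⟩
  r + (i + o) ≡⟨ cong (r +_) (degIn+degOut≡deg G S v) ⟩
  r + deg G v ∎
  where
  open ≤-Reasoning
  o i : ℕ
  o = degOut G S v
  i = degIn G S v

cutSize : ∀ {n} → SimpleGraph n → Subset n → ℕ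
cutSize {n} G S = ∑[ v < n ] (𝟙 (lookup S v) * degOut G S v)

cutSize≡∑-degIn-outside : ∀ {n} (G : SimpleGraph n) S →
  cutSize G S ≡ ∑[ u < n ] (𝟙 (not (lookup S u)) * degIn G S u)
cutSize≡∑-degIn-outside {n} G S = begin
  ∑[ v < n ] (𝟙 (lookup S v) * degOut G S v)
    ≡⟨ sum-cong-≗ (λ v → 𝟙*countB (lookup S v) (λ u → not (lookup S u) ∧ adj G v u)) ⟩
  ∑[ v < n ] ∑[ u < n ] 𝟙 (lookup S v ∧ (not (lookup S u) ∧ adj G v u))
    ≡⟨ sum-cong-≗ (λ v → sum-cong-≗ (λ u → cong 𝟙 (reverse-edge v u))) ⟩
  ∑[ v < n ] ∑[ u < n ] crossingEdge u v
    ≡⟨ ∑-comm (λ v u → crossingEdge u v) ⟩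
  ∑[ u < n ] ∑[ v < n ] crossingEdge u v
    ≡⟨ sum-cong-≗ (λ u → 𝟙*countB (not (lookup S u)) (λ v → lookup S v ∧ adj G u v)) ⟨
  ∑[ u < n ] (𝟙 (not (lookup S u)) * degIn G S u) ∎
  where
  open ≡-Reasoning
  crossingEdge : Fin n → Fin n → ℕ
  crossingEdge u v = 𝟙 (not (lookup S u) ∧ (lookup S v ∧ adj G u v))
  reverse-edge : ∀ v u → lookup S v ∧ (not (lookup S u) ∧ adj G v u)
                       ≡ not (lookup S u) ∧ (lookup S v ∧ adj G u v)
  reverse-edge v u = trans (x∙yz≈y∙xz (lookup S v) (not (lookup S u)) (adj G v u))
    (cong (λ a → not (lookup S u) ∧ (lookup S v ∧ a)) (SimpleGraph.sym G v u))

dominating⇒n≤∣S∣+cutSize : ∀ {n} (G : SimpleGraph n) S → Dominating G S → n ≤ ∣ S ∣ + cutSize G S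
dominating⇒n≤∣S∣+cutSize {n} G S dominates = begin
  n
    ≡⟨ ∑-const-1 n ⟨
  ∑[ u < n ] 1
    ≤⟨ ∑-mono-≤ covered ⟩
  ∑[ u < n ] (𝟙 (lookup S u) + 𝟙 (not (lookup S u)) * degIn G S u)
    ≡⟨ ∑-distrib-+ (𝟙 ∘ lookup S) (λ u → 𝟙 (not (lookup S u)) * degIn G S u) ⟩
  ∑[ u < n ] 𝟙 (lookup S u) + ∑[ u < n ] (𝟙 (not (lookup S u)) * degIn G S u)
    ≡⟨ cong₂ _+_ (∣S∣≡∑𝟙 S) (cutSize≡∑-degIn-outside G S) ⟨
  ∣ S ∣ + cutSize G S ∎
  where
  open ≤-Reasoning
  covered : ∀ u → 1 ≤ 𝟙 (lookup S u) + 𝟙 (not (lookup S u)) * degIn G S u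
  covered u with lookup S u in u∈?S
  ... | true  = s≤s z≤n
  ... | false with dominates u (not-¬ u∈?S ∘ []=⇒lookup)
  ...   | w , w∈S , uw =
    m≤n⇒m≤n+o 0 (1≤countB (λ w → lookup S w ∧ adj G u w) (cong₂ _∧_ ([]=⇒lookup w∈S) uw))

cutSize-bound : ∀ {n} (G : SimpleGraph n) S {k b} →
  (∀ v → v ∈ S → k * degOut G S v ≤ b) → k * cutSize G S ≤ ∣ S ∣ * b
cutSize-bound {n} G S {k} {b} bounded = begin
  k * ∑[ v < n ] (𝟙 (lookup S v) * degOut G S v)
    ≡⟨ *-distribˡ-sum k (λ v → 𝟙 (lookup S v) * degOut G S v) ⟩
  ∑[ v < n ] (k * (𝟙 (lookup S v) * degOut G S v))
    ≤⟨ ∑-mono-≤ bounded′ ⟩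
  ∑[ v < n ] (𝟙 (lookup S v) * b)
    ≡⟨ *-distribʳ-sum b (𝟙 ∘ lookup S) ⟨
  ∑[ v < n ] 𝟙 (lookup S v) * b
    ≡⟨ cong (_* b) (∣S∣≡∑𝟙 S) ⟨
  ∣ S ∣ * b ∎
  where
  open ≤-Reasoning
  bounded′ : ∀ v → k * (𝟙 (lookup S v) * degOut G S v) ≤ 𝟙 (lookup S v) * b
  bounded′ v with lookup S v in v∈?S
  ... | true  rewrite *-identityˡ (degOut G S v) | *-identityˡ b = bounded v (lookup⇒[]= v S v∈?S)
  ... | false = ≤-reflexive (*-zeroʳ k)

-- The factor k lets the defensive case use 2 |N_{V∖S}(v)| ≤ Δ + 1 without rounding (Δ + 1) / 2.
dominating-bound : ∀ {n} (G : SimpleGraph n) S {k b} → Dominating G S →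
  (∀ v → v ∈ S → k * degOut G S v ≤ b) → k * n ≤ ∣ S ∣ * (k + b)
dominating-bound {n} G S {k} {b} dominates bounded = begin
  k * n                       ≤⟨ *-monoʳ-≤ k (dominating⇒n≤∣S∣+cutSize G S dominates) ⟩
  k * (∣ S ∣ + cutSize G S)   ≡⟨ *-distribˡ-+ k ∣ S ∣ (cutSize G S) ⟩
  k * ∣ S ∣ + k * cutSize G S ≤⟨ +-monoʳ-≤ (k * ∣ S ∣) (cutSize-bound G S {k} bounded) ⟩
  k * ∣ S ∣ + ∣ S ∣ * b       ≡⟨ cong (_+ ∣ S ∣ * b) (*-comm k ∣ S ∣) ⟩
  ∣ S ∣ * k + ∣ S ∣ * b       ≡⟨ *-distribˡ-+ ∣ S ∣ k b ⟨
  ∣ S ∣ * (k + b)             ∎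
  where open ≤-Reasoning

defensive⇒2*degOut≤1+Δ : ∀ {n} (G : SimpleGraph n) S → DefensiveAlliance G S →
  ∀ v → v ∈ S → 2 * degOut G S v ≤ suc (maxDeg G)
defensive⇒2*degOut≤1+Δ G S (_ , defends) v v∈S =
  ≤-trans (degOut≤degIn+r⇒2*degOut≤r+deg G S v (defends v v∈S)) (s≤s (deg≤maxDeg G v))

strongDefensive⇒degOut≤Δ/2 : ∀ {n} (G : SimpleGraph n) S → StrongDefensiveAlliance G S →
  ∀ v → v ∈ S → degOut G S v ≤ maxDeg G / 2
strongDefensive⇒degOut≤Δ/2 G S (_ , defends) v v∈S = m*n≤o⇒n≤o/m 2 _ _
  (≤-trans (degOut≤degIn+r⇒2*degOut≤r+deg G S v (m≤n⇒m≤n+o 0 (defends v v∈S))) (deg≤maxDeg G v))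

theorem4 : (n : ℕ) (G : SimpleGraph n) →
    ((S : Subset n) → GlobalDefensiveAlliance G S →
      ⌈ 2 * n / 3 + maxDeg G ⌉ ≤ ∣ S ∣)
    × ((S : Subset n) → GlobalStrongDefensiveAlliance G S →
      ⌈ n / suc (maxDeg G / 2) ⌉ ≤ ∣ S ∣)
theorem4 n G = globalDefensive , globalStrongDefensive
  where
  Δ : ℕ
  Δ = maxDeg G

  globalDefensive : (S : Subset n) → GlobalDefensiveAlliance G S → ⌈ 2 * n / 3 + Δ ⌉ ≤ ∣ S ∣
  globalDefensive S (defensive , dominates) = m≤o*n⇒⌈m/n⌉≤o (2 * n) (3 + Δ) ∣ S ∣
    (dominating-bound G S {k = 2} dominates (defensive⇒2*degOut≤1+Δ G S defensive))

  globalStrongDefensive : (S : Subset n) → GlobalStrongDefensiveAlliance G S →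
    ⌈ n / suc (Δ / 2) ⌉ ≤ ∣ S ∣
  globalStrongDefensive S (strong , dominates) = m≤o*n⇒⌈m/n⌉≤o n (suc (Δ / 2)) ∣ S ∣
    (subst (_≤ ∣ S ∣ * suc (Δ / 2)) (*-identityˡ n)
      (dominating-bound G S {k = 1} dominates λ v v∈S →
        subst (_≤ Δ / 2) (sym (*-identityˡ _)) (strongDefensive⇒degOut≤Δ/2 G S strong v v∈S)))
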